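{- Let $\varphi\in\mathrm{rLTL}(\mathcal P)$. If $\varphi$ admits a weakened version, i.e., there exists $\sigma\in(2^{\mathcal P})^\omega$ with $V(\sigma,\varphi)\in\{0001,0011,0111\}$, then $\varphi$ contains at least one robust always operator $\boxdot$ or at least one robust release operator $\dot{\mathcal R}$.
   Context: Let $\mathcal P$ be a finite nonempty set of atomic propositions, $\Sigma=2^{\mathcal P}$, and for $\sigma\in\Sigma^\omega$ let $\sigma_{i..}$ be its suffix starting at position $i$. $\mathrm{rLTL}(\mathcal P)$ is the set of formulae built from $p\in\mathcal P$ with $\neg,\wedge,\vee$, robust implication $\Rrightarrow$, robust next $\odot$, robust eventually $\dot\Diamond$, robust always $\boxdot$, robust until $\dot{\mathcal U}$, robust release $\dot{\mathcal R}$. Truth values $\mathbb B_5=\{0000,0001,0011,0111,1111\}$ with linear order $0000\prec0001\prec0011\prec0111\prec1111$; $\overline a=0000$ if $a=1111$ and $1111$ otherwise; $a\to b=1111$ if $a\preceq b$, else $b$. Valuation $V:\Sigma^\omega\times\mathrm{rLTL}(\mathcal P)\to\mathbb B_5$, $V_k$ its $k$-th bit: $V(\sigma,p)=1111$ if $p\in\sigma(0)$ else $0000$; $V(\sigma,\neg\varphi)=\overline{V(\sigma,\varphi)}$; $\wedge,\vee$ via $\min,\max$; $V(\sigma,\varphi\Rrightarrow\psi)=V(\sigma,\varphi)\to V(\sigma,\psi)$; $V(\sigma,\odot\varphi)=V(\sigma_{1..},\varphi)$; $V_k(\sigma,\dot\Diamond\varphi)=\sup_iV_k(\sigma_{i..},\varphi)$;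 $V(\sigma,\boxdot\varphi)=(\inf_iV_1(\sigma_{i..},\varphi),\sup_j\inf_{i\ge j}V_2(\sigma_{i..},\varphi),\inf_j\sup_{i\ge j}V_3(\sigma_{i..},\varphi),\sup_iV_4(\sigma_{i..},\varphi))$; $V_k(\sigma,\varphi\dot{\mathcal U}\psi)=\sup_j\min\{V_k(\sigma_{j..},\psi),\inf_{i<j}V_k(\sigma_{i..},\varphi)\}$; with $M_k(j)=\max\{V_k(\sigma_{j..},\psi),\sup_{i<j}V_k(\sigma_{i..},\varphi)\}$: $V_1(\sigma,\varphi\dot{\mathcal R}\psi)=\inf_jM_1(j)$, $V_2=\sup_k\inf_{j\ge k}M_2(j)$, $V_3=\inf_k\sup_{j\ge k}M_3(j)$, $V_4=\sup_jM_4(j)$. -}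

module Defs where

open import Data.Nat using (ℕ; _+_; _<_; _≥_)
open import Data.Fin using (Fin)
open import Data.Bool using (Bool; true)
open import Data.Product using (Σ; _×_; ∃)
open import Data.Sum using (_⊎_)
open import Data.Unit using (⊤)
open import Data.Empty using (⊥)
open import Relation.Nullary using (¬_)
open import Relation.Binary.PropositionalEquality using (_≡_)

-- Atomic propositions: a finite nonempty set 𝒫 ≅ Fin (suc n).
-- Alphabet Σ = 2^𝒫 : a letter is a characteristic function 𝒫 → Bool.
Letter : ℕ → Set
Letter n = Fin n → Bool

Word : ℕ → Set
Word n = ℕ → Letter n

_↑_ : ∀ {n} → Word n → ℕ → Word n
(σ ↑ i) k = σ (i + k)

data rLTL (n : ℕ) : Set where
  atom    : Fin n → rLTL n
  ¬ᶠ_     : rLTL n → rLTL n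
  _∧ᶠ_    : rLTL n → rLTL n → rLTL n
  _∨ᶠ_    : rLTL n → rLTL n → rLTL n
  _⇛_     : rLTL n → rLTL n → rLTL n
  ⊙_      : rLTL n → rLTL n
  ◇̇_      : rLTL n → rLTL n
  ⊡_      : rLTL n → rLTL n
  _𝒰̇_     : rLTL n → rLTL n → rLTL n
  _ℛ̇_     : rLTL n → rLTL n → rLTL n

-- Bit positions 1..4 of a truth value in 𝔹₅
data Bit : Set where
  b1 b2 b3 b4 : Bit

-- V_k(σ, φ) = 1, as a proposition (sup over ℕ = ∃, inf over ℕ = ∀,
-- min = ×, max = ⊎, bit 0/1 = false/true proposition).
-- Bit-wise reading of the 5-valued operations:
--  * overline a = 0000 if a = 1111 else 1111; a = 1111 iff its first bit is 1,
--    so every bit of ¬φ is ¬ V₁(φ).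
--  * a → b = 1111 if a ⪯ b (i.e. all bits of a ≤ those of b), else b;
--    so bit k of a → b is (a ⪯ b) ∨ b_k.
V : ∀ {n} → Bit → Word n → rLTL n → Set
V k σ (atom p)  = σ 0 p ≡ true
V k σ (¬ᶠ φ)    = ¬ V b1 σ φ
V k σ (φ ∧ᶠ ψ)  = V k σ φ × V k σ ψ
V k σ (φ ∨ᶠ ψ)  = V k σ φ ⊎ V k σ ψ
V k σ (φ ⇛ ψ)   = ((j : Bit) → V j σ φ → V j σ ψ) ⊎ V k σ ψ
V k σ (⊙ φ)     = V k (σ ↑ 1) φ
V k σ (◇̇ φ)     = ∃ λ i → V k (σ ↑ i) φ
V b1 σ (⊡ φ)    = ∀ i → V b1 (σ ↑ i) φ
V b2 σ (⊡ φ)    = ∃ λ j → ∀ i → i ≥ j → V b2 (σ ↑ i) φ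
V b3 σ (⊡ φ)    = ∀ j → ∃ λ i → i ≥ j × V b3 (σ ↑ i) φ
V b4 σ (⊡ φ)    = ∃ λ i → V b4 (σ ↑ i) φ
V k σ (φ 𝒰̇ ψ)   = ∃ λ j → V k (σ ↑ j) ψ × (∀ i → i < j → V k (σ ↑ i) φ)
V b1 σ (φ ℛ̇ ψ)  = ∀ j →
                    (V b1 (σ ↑ j) ψ ⊎ (∃ λ i → i < j × V b1 (σ ↑ i) φ))
V b2 σ (φ ℛ̇ ψ)  = ∃ λ l → ∀ j → j ≥ l →
                    (V b2 (σ ↑ j) ψ ⊎ (∃ λ i → i < j × V b2 (σ ↑ i) φ))
V b3 σ (φ ℛ̇ ψ)  = ∀ l → ∃ λ j → j ≥ l ×
                    (V b3 (σ ↑ j) ψ ⊎ (∃ λ i → i < j × V b3 (σ ↑ i) φ))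
V b4 σ (φ ℛ̇ ψ)  = ∃ λ j →
                    (V b4 (σ ↑ j) ψ ⊎ (∃ λ i → i < j × V b4 (σ ↑ i) φ))

-- V(σ, φ) ∈ {0001, 0011, 0111}: first bit 0 and last bit 1
-- (truth values in 𝔹₅ are monotone bit strings).
WeakenedValue : ∀ {n} → Word n → rLTL n → Set
WeakenedValue σ φ = ¬ V b1 σ φ × V b4 σ φ

ContainsAlwaysOrRelease : ∀ {n} → rLTL n → Set
ContainsAlwaysOrRelease (atom p) = ⊥
ContainsAlwaysOrRelease (¬ᶠ φ) = ContainsAlwaysOrRelease φ
ContainsAlwaysOrRelease (φ ∧ᶠ ψ) = ContainsAlwaysOrRelease φ ⊎ ContainsAlwaysOrRelease ψ
ContainsAlwaysOrRelease (φ ∨ᶠ ψ) = ContainsAlwaysOrRelease φ ⊎ ContainsAlwaysOrRelease ψ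
ContainsAlwaysOrRelease (φ ⇛ ψ) = ContainsAlwaysOrRelease φ ⊎ ContainsAlwaysOrRelease ψ
ContainsAlwaysOrRelease (⊙ φ) = ContainsAlwaysOrRelease φ
ContainsAlwaysOrRelease (◇̇ φ) = ContainsAlwaysOrRelease φ
ContainsAlwaysOrRelease (⊡ φ) = ⊤
ContainsAlwaysOrRelease (φ 𝒰̇ ψ) = ContainsAlwaysOrRelease φ ⊎ ContainsAlwaysOrRelease ψ
ContainsAlwaysOrRelease (φ ℛ̇ ψ) = ⊤

{-# OPTIONS --safe #-}
module Submission where

-- Every operator other than ⊡ and ℛ̇ computes each bit of its value from the
-- same bit of its arguments (negation and the guard of ⇛ only look at whole
-- values). So, by induction, a formula without ⊡ and ℛ̇ has all four bits equal
-- on every word, i.e. takes only the values 0000 and 1111, and can never have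
-- first bit 0 and last bit 1.

open import Defs
open import Data.Nat using (ℕ; suc)
open import Data.Product using (∃; _,_)
open import Data.Sum using (_⊎_; inj₁; inj₂; map₂)
open import Relation.Nullary using (¬_; contradiction)

BitUniform : ∀ {n} → rLTL n → Set
BitUniform {n} φ = ∀ k k′ (σ : Word n) → V k σ φ → V k′ σ φ

either₂ : {A B U W X : Set} → A ⊎ U → B ⊎ W → (U → W → X) → (A ⊎ B) ⊎ X
either₂ (inj₁ a) _        _ = inj₁ (inj₁ a)
either₂ (inj₂ _) (inj₁ b) _ = inj₁ (inj₂ b)
either₂ (inj₂ u) (inj₂ w) f = inj₂ (f u w)

containsAlwaysOrRelease⊎bitUniform :
  ∀ {n} (φ : rLTL n) → ContainsAlwaysOrRelease φ ⊎ BitUniform φ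
containsAlwaysOrRelease⊎bitUniform (atom p) = inj₂ λ _ _ _ x → x
containsAlwaysOrRelease⊎bitUniform (¬ᶠ φ) =
  map₂ (λ _ _ _ _ x → x) (containsAlwaysOrRelease⊎bitUniform φ)
containsAlwaysOrRelease⊎bitUniform (φ ∧ᶠ ψ) =
  either₂ (containsAlwaysOrRelease⊎bitUniform φ) (containsAlwaysOrRelease⊎bitUniform ψ)
    λ u w k k′ σ (x , y) → u k k′ σ x , w k k′ σ y
containsAlwaysOrRelease⊎bitUniform (φ ∨ᶠ ψ) =
  either₂ (containsAlwaysOrRelease⊎bitUniform φ) (containsAlwaysOrRelease⊎bitUniform ψ)
    λ { u w k k′ σ (inj₁ x) → inj₁ (u k k′ σ x)
      ; u w k k′ σ (inj₂ y) → inj₂ (w k k′ σ y) }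
containsAlwaysOrRelease⊎bitUniform (φ ⇛ ψ) =
  either₂ (containsAlwaysOrRelease⊎bitUniform φ) (containsAlwaysOrRelease⊎bitUniform ψ)
    λ { _ w k k′ σ (inj₁ φ≼ψ) → inj₁ φ≼ψ
      ; _ w k k′ σ (inj₂ y)   → inj₂ (w k k′ σ y) }
containsAlwaysOrRelease⊎bitUniform (⊙ φ) =
  map₂ (λ u k k′ σ → u k k′ (σ ↑ 1)) (containsAlwaysOrRelease⊎bitUniform φ)
containsAlwaysOrRelease⊎bitUniform (◇̇ φ) =
  map₂ (λ u k k′ σ (i , x) → i , u k k′ (σ ↑ i) x) (containsAlwaysOrRelease⊎bitUniform φ)
containsAlwaysOrRelease⊎bitUniform (⊡ φ) = inj₁ _
containsAlwaysOrRelease⊎bitUniform (φ 𝒰̇ ψ) =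
  either₂ (containsAlwaysOrRelease⊎bitUniform φ) (containsAlwaysOrRelease⊎bitUniform ψ)
    λ u w k k′ σ (j , y , before) →
      j , w k k′ (σ ↑ j) y , λ i i<j → u k k′ (σ ↑ i) (before i i<j)
containsAlwaysOrRelease⊎bitUniform (φ ℛ̇ ψ) = inj₁ _

bitUniform⇒¬weakenedValue : ∀ {n} (φ : rLTL n) → BitUniform φ → ∀ σ → ¬ WeakenedValue σ φ
bitUniform⇒¬weakenedValue φ u σ (¬v₁ , v₄) = ¬v₁ (u b4 b1 σ v₄)

mainTheorem3 : (n : ℕ) (φ : rLTL (suc n)) →
    (∃ λ (σ : Word (suc n)) → WeakenedValue σ φ) →
    ContainsAlwaysOrRelease φ
mainTheorem3 n φ (σ , weakened) with containsAlwaysOrRelease⊎bitUniform φ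
... | inj₁ contains = contains
... | inj₂ uniform  = contradiction weakened (bitUniform⇒¬weakenedValue φ uniform σ)
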